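{- Suppose $\Gamma\vdash\lambda a.\lambda\Delta.M$ is derivable; then $\Gamma\vdash\lambda b.\lambda\Delta.\Uparrow_{\Delta}\!\langle\pi_b\,,\,b\backslash a\rangle\circ M$ is derivable.
   Context: Calculus $\lambda\pi$: terms $M,N::= a\mid MN\mid\lambda a.M\mid s\circ M$, substitutions $s,q::= id\mid\pi_a\mid\langle s\,,\,N\backslash a\rangle\mid s\circ q$ ($\langle s\,,\,N\backslash a\rangle$ = $s$ extended by "$N$ for $a$"). Contexts are finite lists of variables with repetitions. Derivable judgements: (i) $\Gamma,a\vdash a$; (ii) $\Gamma\vdash a\Rightarrow\Gamma,b\vdash a$ ($a\neq b$); (iii) $\Gamma\vdash M,\Gamma\vdash N\Rightarrow\Gamma\vdash MN$; (iv) $\Gamma,a\vdash M\Rightarrow\Gamma\vdash\lambda a.M$; (v) $\Gamma\vdash s\triangleright\Delta,\Delta\vdash M\Rightarrow\Gamma\vdash s\circ M$; (vi) $\Gamma\vdash id\triangleright\Gamma$; (vii) $\Gamma,a\vdash\pi_a\triangleright\Gamma$; (viii) $\Gamma\vdash s\triangleright\Delta,\Gamma\vdash N\Rightarrow\Gamma\vdash\langle s\,,\,N\backslash a\rangle\triangleright\Delta,a$; (ix) $\Gamma\vdash s\triangleright\Delta,\Delta\vdash q\triangleright\Sigma\Rightarrow\Gamma\vdash s\circ q\triangleright\Sigma$. Notation: $\lambda\,nil.M\equiv M$, $\lambda\Sigma,a.M\equiv\lambda\Sigma.(\lambda a.M)$; $\Uparrow_{nil}(s)\equiv s$, $\Uparrow_{\Sigma,a}(s)\equiv\langle\pi_a\circ\Uparrow_\Sigma(s)\,,\,a\backslash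 a\rangle$. -}

module Defs where

open import Data.Nat using (ℕ)
open import Relation.Binary.PropositionalEquality using (_≡_; _≢_)

Var : Set
Var = ℕ

mutual
  data Term : Set where
    var  : Var → Term
    app  : Term → Term → Term
    lam  : Var → Term → Term
    _∘ₜ_ : Subst → Term → Term

  data Subst : Set where
    idₛ  : Subst
    π    : Var → Subst
    ⟨_,_∖_⟩ : Subst → Term → Var → Subst
    _∘ₛ_ : Subst → Subst → Subst

infixr 6 _∘ₜ_ _∘ₛ_

-- Contexts: finite lists of variables (repetitions allowed), extended on the right.
data Ctx : Set where
  nil : Ctx
  _▸_ : Ctx → Var → Ctx

infixl 5 _▸_

mutual
  data _⊢_ : Ctx → Term → Set where
    ax   : ∀ {Γ a} → (Γ ▸ a) ⊢ var a
    weak : ∀ {Γ a b} → Γ ⊢ var a → a ≢ b → (Γ ▸ b) ⊢ var a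
    appI : ∀ {Γ M N} → Γ ⊢ M → Γ ⊢ N → Γ ⊢ app M N
    lamI : ∀ {Γ a M} → (Γ ▸ a) ⊢ M → Γ ⊢ lam a M
    cloI : ∀ {Γ Δ s M} → Γ ⊢ s ▷ Δ → Δ ⊢ M → Γ ⊢ (s ∘ₜ M)

  data _⊢_▷_ : Ctx → Subst → Ctx → Set where
    idI   : ∀ {Γ} → Γ ⊢ idₛ ▷ Γ
    πI    : ∀ {Γ a} → (Γ ▸ a) ⊢ π a ▷ Γ
    consI : ∀ {Γ Δ s N a} → Γ ⊢ s ▷ Δ → Γ ⊢ N → Γ ⊢ ⟨ s , N ∖ a ⟩ ▷ (Δ ▸ a)
    compI : ∀ {Γ Δ Σ s q} → Γ ⊢ s ▷ Δ → Δ ⊢ q ▷ Σ → Γ ⊢ (s ∘ₛ q) ▷ Σ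

lams : Ctx → Term → Term
lams nil M = M
lams (Σ ▸ a) M = lams Σ (lam a M)

lift : Ctx → Subst → Subst
lift nil s = s
lift (Σ ▸ a) s = ⟨ π a ∘ₛ lift Σ s , var a ∖ a ⟩

module Submission where

open import Defs

-- A derivation of  Γ ⊢ λΔ.M  is nothing but a derivation of  Γ,Δ ⊢ M
-- (rule (iv) applied once per variable of Δ), so both directions of this
-- correspondence are proved first.  Next, lifting preserves typing:
-- if  Γ ⊢ s ▷ Θ  then  Γ,Σ ⊢ ⇑_Σ(s) ▷ Θ,Σ.  The basic renaming
-- ⟨π_b , b\a⟩  sends  Γ,b  to  Γ,a, hence its lift over Δ sends  Γ,b,Δ
-- to  Γ,a,Δ.  The theorem follows: strip  λa.λΔ  to get  Γ,a,Δ ⊢ M,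
-- close  M  with the lifted renaming by rule (v), and re-abstract over
-- b  and  Δ.

_++_ : Ctx → Ctx → Ctx
Γ ++ nil     = Γ
Γ ++ (Δ ▸ x) = (Γ ++ Δ) ▸ x

infixl 5 _++_

lam-inv : ∀ {Γ a M} → Γ ⊢ lam a M → (Γ ▸ a) ⊢ M
lam-inv (lamI d) = d

lams-inv : ∀ Γ Δ M → Γ ⊢ lams Δ M → (Γ ++ Δ) ⊢ M
lams-inv Γ nil     M d = d
lams-inv Γ (Δ ▸ x) M d = lam-inv (lams-inv Γ Δ (lam x M) d)

lams-intro : ∀ Γ Δ M → (Γ ++ Δ) ⊢ M → Γ ⊢ lams Δ M
lams-intro Γ nil     M d = d
lams-intro Γ (Δ ▸ x) M d = lams-intro Γ Δ (lam x M) (lamI d)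

lift-typed : ∀ {Γ Θ s} Σ → Γ ⊢ s ▷ Θ → (Γ ++ Σ) ⊢ lift Σ s ▷ (Θ ++ Σ)
lift-typed nil     ds = ds
lift-typed (Σ ▸ x) ds = consI (compI πI (lift-typed Σ ds)) ax

rename-typed : ∀ Γ a b → (Γ ▸ b) ⊢ ⟨ π b , var b ∖ a ⟩ ▷ (Γ ▸ a)
rename-typed Γ a b = consI πI ax

mainTheorem3 : ∀ (Γ Δ : Ctx) (a b : Var) (M : Term)
    → Γ ⊢ lam a (lams Δ M)
    → Γ ⊢ lam b (lams Δ (lift Δ ⟨ π b , var b ∖ a ⟩ ∘ₜ M))
mainTheorem3 Γ Δ a b M d = lamI (lams-intro (Γ ▸ b) Δ _ (cloI renamingΔ body))
  where
    body : (Γ ▸ a ++ Δ) ⊢ M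
    body = lams-inv (Γ ▸ a) Δ M (lam-inv d)

    renamingΔ : (Γ ▸ b ++ Δ) ⊢ lift Δ ⟨ π b , var b ∖ a ⟩ ▷ (Γ ▸ a ++ Δ)
    renamingΔ = lift-typed Δ (rename-typed Γ a b)
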